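{- Let $m\ge4$ be an integer and $p$ a prime. There exists a Type I solution $(x,y,z)\in\mathbb N^3$ of $\frac mp=\frac1x+\frac1y+\frac1z$ if and only if there exist $a,d,f\in\mathbb N$ with $f\mid ma^2d+1$ and $mad\mid p+f$.
   Context: $\mathbb N$ denotes the positive integers. A solution $(x,y,z)\in\mathbb N^3$ of $\frac mn=\frac1x+\frac1y+\frac1z$ is of Type I if $n$ divides $x$ but $n$ is coprime to $y$ and to $z$. -}

module Defs where

open import Data.Nat using (ℕ; _+_; _*_; _≤_)
open import Data.Nat.Divisibility using (_∣_)
open import Data.Nat.Coprimality using (Coprime)
open import Data.Product using (_×_)
open import Relation.Binary.PropositionalEquality using (_≡_)

-- (x,y,z) ∈ ℕ³ (positive) solves m/n = 1/x + 1/y + 1/z.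
-- With x,y,z,n > 0 this equation is equivalent to m·x·y·z = n·(yz + xz + xy)
-- (multiply through by n·x·y·z).
IsSolution : ℕ → ℕ → ℕ → ℕ → ℕ → Set
IsSolution m n x y z =
  (1 ≤ x) × (1 ≤ y) × (1 ≤ z) ×
  (m * x * y * z ≡ n * (y * z + x * z + x * y))

IsTypeI : ℕ → ℕ → ℕ → ℕ → ℕ → Set
IsTypeI m n x y z =
  IsSolution m n x y z × (n ∣ x) × Coprime n y × Coprime n z

{-# OPTIONS --safe #-}
-- A Type I solution has x = n t, and then m t y z = y z + n t (y + z). Write y = a g, z = b g with
-- g = gcd(y, z). Then a b ∣ n t (a + b), and a, b are prime to n and to a + b, so t = d a b; then
-- d ∣ g, say g = c d. Hence x = a b d n, y = a c d, z = b c d with m a b c d = n (a + b) + c and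
-- n ∤ c. Put f = m a c d − n: the equation becomes f (a + b) = c (m a² d + 1), and gcd(f, c)
-- divides gcd(n, c) = 1, so f ∣ m a² d + 1. Conversely, if f e = m a² d + 1 and n + f = c · m a d,
-- then b = c e − a restores the equation. For m ≥ 4 the equation forbids p ∣ c, since c = k p would
-- give m a b k d = a + b + k; and p ∣ a, b or d would force p ∣ c, so y and z are prime to p.

module Submission where

open import Defs
open import Data.Nat using (ℕ; _+_; _*_; _≤_)
open import Data.Nat.Divisibility using (_∣_)
open import Data.Nat.Primality using (Prime)
open import Data.Product using (_×_; ∃-syntax)
open import Function.Bundles using (_⇔_)

open import Data.Nat.Base using (_<_; _∸_; NonZero; ≢-nonZero; ≢-nonZero⁻¹; >-nonZero; >-nonZero⁻¹)
open import Data.Nat.Properties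
open import Data.Nat.Divisibility
  using (divides; divides-refl; ∣-trans; ∣⇒≤; ∣m+n∣m⇒∣n; m∣m*n; n∣m*n; n∣m*n*o; ∣m⇒∣m*n; *-monoʳ-∣)
open import Data.Nat.DivMod using (_/_; m/n*n≡m)
open import Data.Nat.GCD using (gcd; gcd[m,n]∣m; gcd[m,n]∣n; gcd[m,n]≢0)
open import Data.Nat.Coprimality
  using (Coprime; coprime-+; coprime-divisor; coprime-/gcd) renaming (sym to coprime-sym)
open import Data.Nat.Primality using (prime⇒irreducible; prime⇒nonZero)
open import Data.Nat.Tactic.RingSolver using (solve)
open import Data.List.Base using (_∷_; [])
open import Data.Product using (_,_)
open import Data.Sum using (inj₁; inj₂)
open import Function.Bundles using (mk⇔)
open import Relation.Nullary using (¬_; contradiction)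
open import Relation.Binary.PropositionalEquality
  using (_≡_; refl; sym; trans; cong; cong₂; subst; module ≡-Reasoning)

prime∤⇒coprime : ∀ {p n} → Prime p → ¬ p ∣ n → Coprime p n
prime∤⇒coprime p-prime p∤n (i∣p , i∣n) with prime⇒irreducible p-prime i∣p
... | inj₁ i≡1 = i≡1
... | inj₂ refl = contradiction i∣n p∤n

coprime-∣ʳ : ∀ {m n d} → Coprime m n → d ∣ n → Coprime m d
coprime-∣ʳ m⊥n d∣n (i∣m , i∣d) = m⊥n (i∣m , ∣-trans i∣d d∣n)

coprime-complement : ∀ {n c f} → Coprime n c → c ∣ n + f → Coprime f c
coprime-complement {n} {c} {f} n⊥c c∣n+f {i} (i∣f , i∣c) =
  n⊥c (∣m+n∣m⇒∣n (subst (i ∣_) (+-comm n f) (∣-trans i∣c c∣n+f)) i∣f , i∣c)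

coprime⇒*∣ : ∀ {a b n} → Coprime a b → a ∣ n → b ∣ n → a * b ∣ n
coprime⇒*∣ {a} {b} a⊥b (divides-refl u) b∣ua =
  subst (a * b ∣_) (*-comm a u)
    (*-monoʳ-∣ a (coprime-divisor (coprime-sym a⊥b) (subst (b ∣_) (*-comm u a) b∣ua)))

coprime∧∣n*t*[a+b]⇒∣t : ∀ {a b n t} → Coprime a b → Coprime a n → a ∣ n * t * (a + b) → a ∣ t
coprime∧∣n*t*[a+b]⇒∣t {a} {b} {n} {t} a⊥b a⊥n a∣ntab =
  coprime-divisor a⊥a+b (subst (a ∣_) (*-comm t (a + b))
    (coprime-divisor a⊥n (subst (a ∣_) (*-assoc n t (a + b)) a∣ntab)))
  where
  a⊥a+b : Coprime a (a + b)
  a⊥a+b = coprime-sym (coprime-+ (coprime-sym a⊥b))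

coprime-cofactors : ∀ y z .{{_ : NonZero y}} →
  ∃[ a ] ∃[ b ] ∃[ g ] (Coprime a b × y ≡ a * g × z ≡ b * g)
coprime-cofactors y z =
  y / g , z / g , g , coprime-/gcd y z ,
  sym (m/n*n≡m (gcd[m,n]∣m y z)) , sym (m/n*n≡m (gcd[m,n]∣n y z))
  where
  g = gcd y z
  instance
    g≢0 : NonZero g
    g≢0 = ≢-nonZero (gcd[m,n]≢0 y z (inj₁ (≢-nonZero⁻¹ y)))

a+b+k<m*a*b*k*d : ∀ m a b k d → 4 ≤ m → 1 ≤ a → 1 ≤ b → 1 ≤ k → 1 ≤ d →
  a + b + k < m * a * b * k * d
a+b+k<m*a*b*k*d m a b k d 4≤m a≥1 b≥1 k≥1 d≥1 = begin-strict
  a + b + k                                             ≤⟨ +-mono-≤ (+-mono-≤ a≤P b≤P) k≤P ⟩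
  a * b * k * d + a * b * k * d + a * b * k * d         <⟨ m<m+n _ P≥1 ⟩
  a * b * k * d + a * b * k * d + a * b * k * d + a * b * k * d
                                                        ≡⟨ solve (a ∷ b ∷ k ∷ d ∷ []) ⟩
  4 * (a * b * k * d)                                   ≤⟨ *-monoˡ-≤ _ 4≤m ⟩
  m * (a * b * k * d)                                   ≡⟨ solve (m ∷ a ∷ b ∷ k ∷ d ∷ []) ⟩
  m * a * b * k * d                                     ∎
  where
  open ≤-Reasoning
  P≥1 : 1 ≤ a * b * k * d
  P≥1 = *-mono-≤ (*-mono-≤ (*-mono-≤ a≥1 b≥1) k≥1) d≥1
  instance
    P≢0 : NonZero (a * b * k * d)
    P≢0 = >-nonZero P≥1
  a≤P : a ≤ a * b * k * d
  a≤P = ∣⇒≤ (∣m⇒∣m*n d (∣m⇒∣m*n k (m∣m*n b)))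
  b≤P : b ≤ a * b * k * d
  b≤P = ∣⇒≤ (∣m⇒∣m*n d (n∣m*n*o a k))
  k≤P : k ≤ a * b * k * d
  k≤P = ∣⇒≤ (∣m⇒∣m*n d (n∣m*n (a * b)))

TypeIParameters : ℕ → ℕ → Set
TypeIParameters m n = ∃[ a ] ∃[ b ] ∃[ c ] ∃[ d ]
  (1 ≤ a × 1 ≤ c × 1 ≤ d × Coprime n c × m * a * b * c * d ≡ n * (a + b) + c)

gcd-equation⇒parameters : ∀ m n a b d g .{{_ : NonZero a}} .{{_ : NonZero d}} .{{_ : NonZero g}} →
  Coprime n g → m * d * a * b * g ≡ n * d * (a + b) + g → TypeIParameters m n
gcd-equation⇒parameters m n a b d g n⊥g eq with d∣g
  where
  d∣g : d ∣ g
  d∣g = ∣m+n∣m⇒∣n (subst (d ∣_) eq (∣m⇒∣m*n g (∣m⇒∣m*n b (n∣m*n*o m a)))) (n∣m*n*o n (a + b))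
... | divides-refl c =
  a , b , c , d , >-nonZero⁻¹ a , >-nonZero⁻¹ c {{m*n≢0⇒m≢0 c}} , >-nonZero⁻¹ d ,
  coprime-∣ʳ n⊥g (m∣m*n d) , eq′
  where
  open ≡-Reasoning
  eq′ : m * a * b * c * d ≡ n * (a + b) + c
  eq′ = *-cancelˡ-≡ _ _ d (begin
    d * (m * a * b * c * d) ≡⟨ solve (m ∷ a ∷ b ∷ c ∷ d ∷ []) ⟩
    m * d * a * b * (c * d) ≡⟨ eq ⟩
    n * d * (a + b) + c * d ≡⟨ solve (n ∷ a ∷ b ∷ c ∷ d ∷ []) ⟩
    d * (n * (a + b) + c)   ∎)

cofactor-equation⇒parameters : ∀ m n a b g t .{{_ : NonZero a}} .{{_ : NonZero g}} .{{_ : NonZero t}} →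
  Coprime a b → Coprime n a → Coprime n b → Coprime n g →
  m * t * a * b * g ≡ a * b * g + n * t * (a + b) → TypeIParameters m n
cofactor-equation⇒parameters m n a b g t a⊥b n⊥a n⊥b n⊥g eq with ab∣t
  where
  ab∣ntab : a * b ∣ n * t * (a + b)
  ab∣ntab = ∣m+n∣m⇒∣n (subst (a * b ∣_) eq (divides (m * t * g) (solve (m ∷ t ∷ a ∷ b ∷ g ∷ []))))
                      (m∣m*n g)
  ab∣t : a * b ∣ t
  ab∣t = coprime⇒*∣ a⊥b
    (coprime∧∣n*t*[a+b]⇒∣t a⊥b (coprime-sym n⊥a) (∣-trans (m∣m*n b) ab∣ntab))
    (coprime∧∣n*t*[a+b]⇒∣t (coprime-sym a⊥b) (coprime-sym n⊥b)
      (subst (λ s → b ∣ n * t * s) (+-comm a b) (∣-trans (n∣m*n a) ab∣ntab)))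
... | divides-refl d = gcd-equation⇒parameters m n a b d g n⊥g eq′
  where
  open ≡-Reasoning
  instance
    d≢0 : NonZero d
    d≢0 = m*n≢0⇒m≢0 d
    ab≢0 : NonZero (a * b)
    ab≢0 = m*n≢0⇒n≢0 d
  eq′ : m * d * a * b * g ≡ n * d * (a + b) + g
  eq′ = *-cancelˡ-≡ _ _ (a * b) (begin
    a * b * (m * d * a * b * g)             ≡⟨ solve (m ∷ d ∷ a ∷ b ∷ g ∷ []) ⟩
    m * (d * (a * b)) * a * b * g           ≡⟨ eq ⟩
    a * b * g + n * (d * (a * b)) * (a + b) ≡⟨ solve (n ∷ d ∷ a ∷ b ∷ g ∷ []) ⟩
    a * b * (n * d * (a + b) + g)           ∎)

typeI-equation⇒parameters : ∀ m n t y z .{{_ : NonZero t}} .{{_ : NonZero y}} →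
  Coprime n y → Coprime n z → m * t * y * z ≡ y * z + n * t * (y + z) → TypeIParameters m n
typeI-equation⇒parameters m n t y z n⊥y n⊥z eq with coprime-cofactors y z
... | a , b , g , a⊥b , refl , refl = cofactor-equation⇒parameters m n a b g t a⊥b
  (coprime-∣ʳ n⊥y (m∣m*n g)) (coprime-∣ʳ n⊥z (m∣m*n g)) (coprime-∣ʳ n⊥y (n∣m*n a)) eq′
  where
  open ≡-Reasoning
  instance
    a≢0 : NonZero a
    a≢0 = m*n≢0⇒m≢0 a
    g≢0 : NonZero g
    g≢0 = m*n≢0⇒n≢0 a
  eq′ : m * t * a * b * g ≡ a * b * g + n * t * (a + b)
  eq′ = *-cancelˡ-≡ _ _ g (begin
    g * (m * t * a * b * g)                   ≡⟨ solve (m ∷ t ∷ a ∷ b ∷ g ∷ []) ⟩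
    m * t * (a * g) * (b * g)                 ≡⟨ eq ⟩
    a * g * (b * g) + n * t * (a * g + b * g) ≡⟨ solve (n ∷ t ∷ a ∷ b ∷ g ∷ []) ⟩
    g * (a * b * g + n * t * (a + b))         ∎)

typeI⇒parameters : ∀ m n {x y z} → IsTypeI m n x y z → TypeIParameters m n
typeI⇒parameters m n {_} {y} {z} ((tn≥1 , y≥1 , _ , eq) , divides-refl t , n⊥y , n⊥z) =
  typeI-equation⇒parameters m n t y z n⊥y n⊥z eq′
  where
  open ≡-Reasoning
  instance
    t≢0 : NonZero t
    t≢0 = m*n≢0⇒m≢0 t {{>-nonZero tn≥1}}
    n≢0 : NonZero n
    n≢0 = m*n≢0⇒n≢0 t {{>-nonZero tn≥1}}
    y≢0 : NonZero y
    y≢0 = >-nonZero y≥1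
  eq′ : m * t * y * z ≡ y * z + n * t * (y + z)
  eq′ = *-cancelˡ-≡ _ _ n (begin
    n * (m * t * y * z)                 ≡⟨ solve (m ∷ n ∷ t ∷ y ∷ z ∷ []) ⟩
    m * (t * n) * y * z                 ≡⟨ eq ⟩
    n * (y * z + t * n * z + t * n * y) ≡⟨ cong (n *_) (solve (n ∷ t ∷ y ∷ z ∷ [])) ⟩
    n * (y * z + n * t * (y + z))       ∎)

parameters⇒divisibility : ∀ m n a b c d → 1 ≤ c → Coprime n c →
  m * a * b * c * d ≡ n * (a + b) + c →
  ∃[ f ] (1 ≤ f × f ∣ m * a * a * d + 1 × m * a * d ∣ n + f)
parameters⇒divisibility m n a b c d c≥1 n⊥c eq =
  N ∸ n , m<n⇒0<n∸m n<N ,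
  coprime-divisor f⊥c (divides (a + b) excess) , divides c n+f≡N
  where
  N : ℕ
  N = c * (m * a * d)
  split : c * (m * a * d) * (a + b) ≡ c * (m * a * a * d + 1) + n * (a + b)
  split = begin
    c * (m * a * d) * (a + b)               ≡⟨ solve (m ∷ a ∷ b ∷ c ∷ d ∷ []) ⟩
    c * (m * a * a * d) + m * a * b * c * d ≡⟨ cong (c * (m * a * a * d) +_) eq ⟩
    c * (m * a * a * d) + (n * (a + b) + c) ≡⟨ solve (m ∷ n ∷ a ∷ b ∷ c ∷ d ∷ []) ⟩
    c * (m * a * a * d + 1) + n * (a + b)   ∎
    where open ≡-Reasoning
  n<N : n < N
  n<N = *-cancelʳ-< (a + b) n N (begin-strict
    n * (a + b)                           <⟨ m<n+m _ (*-mono-≤ c≥1 (m≤n+m 1 _)) ⟩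
    c * (m * a * a * d + 1) + n * (a + b) ≡⟨ sym split ⟩
    N * (a + b)                           ∎)
    where open ≤-Reasoning
  n+f≡N : n + (N ∸ n) ≡ N
  n+f≡N = m+[n∸m]≡n (<⇒≤ n<N)
  f⊥c : Coprime (N ∸ n) c
  f⊥c = coprime-complement n⊥c (divides (m * a * d) (trans n+f≡N (*-comm c _)))
  excess : c * (m * a * a * d + 1) ≡ (a + b) * (N ∸ n)
  excess = +-cancelʳ-≡ (n * (a + b)) _ _ (begin
    c * (m * a * a * d + 1) + n * (a + b) ≡⟨ sym split ⟩
    N * (a + b)                           ≡⟨ cong (_* (a + b)) (sym n+f≡N) ⟩
    (n + (N ∸ n)) * (a + b)               ≡⟨ *-distribʳ-+ (a + b) n (N ∸ n) ⟩
    n * (a + b) + (N ∸ n) * (a + b)       ≡⟨ +-comm (n * (a + b)) _ ⟩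
    (N ∸ n) * (a + b) + n * (a + b)       ≡⟨ cong (_+ n * (a + b)) (*-comm (N ∸ n) (a + b)) ⟩
    (a + b) * (N ∸ n) + n * (a + b)       ∎)
    where open ≡-Reasoning

divisibility⇒parameters : ∀ m n a d f → 1 ≤ f → f ∣ m * a * a * d + 1 → m * a * d ∣ n + f →
  ∃[ b ] ∃[ c ] (1 ≤ b × 1 ≤ c × m * a * b * c * d ≡ n * (a + b) + c)
divisibility⇒parameters m n a d f f≥1 (divides e fe) (divides c nf) =
  c * e ∸ a , c , m<n⇒0<n∸m a<ce , c≥1 , equation (c * e ∸ a) (m+[n∸m]≡n (<⇒≤ a<ce))
  where
  c≥1 : 1 ≤ c
  c≥1 = >-nonZero⁻¹ c {{m*n≢0⇒m≢0 c {{>-nonZero (subst (1 ≤_) nf (≤-trans f≥1 (m≤n+m f n)))}}}}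
  a<ce : a < c * e
  a<ce = *-cancelˡ-< (f * (m * a * d)) a (c * e) (begin-strict
    f * (m * a * d) * a           ≡⟨ solve (m ∷ a ∷ d ∷ f ∷ []) ⟩
    f * (m * a * a * d)           <⟨ m<m+n _ f≥1 ⟩
    f * (m * a * a * d) + f       ≡⟨ solve (m ∷ a ∷ d ∷ f ∷ []) ⟩
    f * (m * a * a * d + 1)       ≤⟨ *-monoˡ-≤ _ (m≤n+m f n) ⟩
    (n + f) * (m * a * a * d + 1) ≡⟨ cong₂ _*_ nf fe ⟩
    c * (m * a * d) * (e * f)     ≡⟨ solve (m ∷ a ∷ c ∷ d ∷ e ∷ f ∷ []) ⟩
    f * (m * a * d) * (c * e)     ∎)
    where open ≤-Reasoning
  equation : ∀ b → a + b ≡ c * e → m * a * b * c * d ≡ n * (a + b) + c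
  equation b a+b≡ce = +-cancelʳ-≡ (f * (a + b)) _ _ (begin
    m * a * b * c * d + f * (a + b)             ≡⟨ cong (λ u → m * a * b * c * d + f * u) a+b≡ce ⟩
    m * a * b * c * d + f * (c * e)             ≡⟨ solve (m ∷ a ∷ b ∷ c ∷ d ∷ e ∷ f ∷ []) ⟩
    m * a * b * c * d + c * (e * f)             ≡⟨ cong (λ u → m * a * b * c * d + c * u) (sym fe) ⟩
    m * a * b * c * d + c * (m * a * a * d + 1) ≡⟨ solve (m ∷ a ∷ b ∷ c ∷ d ∷ []) ⟩
    c * (m * a * d) * (a + b) + c               ≡⟨ cong (λ u → u * (a + b) + c) (sym nf) ⟩
    (n + f) * (a + b) + c                       ≡⟨ solve (n ∷ a ∷ b ∷ c ∷ f ∷ []) ⟩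
    n * (a + b) + c + f * (a + b)               ∎)
    where open ≡-Reasoning

parameters⇒∤c : ∀ m n a b c d → 4 ≤ m → 1 ≤ a → 1 ≤ b → 1 ≤ c → 1 ≤ d →
  m * a * b * c * d ≡ n * (a + b) + c → ¬ n ∣ c
parameters⇒∤c m n a b .(k * n) d 4≤m a≥1 b≥1 kn≥1 d≥1 eq (divides-refl k) =
  <⇒≢ (a+b+k<m*a*b*k*d m a b k d 4≤m a≥1 b≥1 k≥1 d≥1) (sym eq′)
  where
  instance
    kn≢0 : NonZero (k * n)
    kn≢0 = >-nonZero kn≥1
    n≢0 : NonZero n
    n≢0 = m*n≢0⇒n≢0 k
  k≥1 : 1 ≤ k
  k≥1 = >-nonZero⁻¹ k {{m*n≢0⇒m≢0 k}}
  eq′ : m * a * b * k * d ≡ a + b + k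
  eq′ = *-cancelˡ-≡ _ _ n (begin
    n * (m * a * b * k * d)   ≡⟨ solve (m ∷ n ∷ a ∷ b ∷ k ∷ d ∷ []) ⟩
    m * a * b * (k * n) * d   ≡⟨ eq ⟩
    n * (a + b) + k * n       ≡⟨ solve (n ∷ a ∷ b ∷ k ∷ []) ⟩
    n * (a + b + k)           ∎)
    where open ≡-Reasoning

parameters⇒typeI : ∀ m p a b c d → Prime p → 4 ≤ m → 1 ≤ a → 1 ≤ b → 1 ≤ c → 1 ≤ d →
  m * a * b * c * d ≡ p * (a + b) + c → IsTypeI m p (a * b * d * p) (a * c * d) (b * c * d)
parameters⇒typeI m p a b c d p-prime 4≤m a≥1 b≥1 c≥1 d≥1 eq =
  (x≥1 , y≥1 , z≥1 , solution) , divides (a * b * d) refl ,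
  prime∤⇒coprime p-prime (p∤ (a * c * d) (divides (m * b) (solve (m ∷ a ∷ b ∷ c ∷ d ∷ [])))) ,
  prime∤⇒coprime p-prime (p∤ (b * c * d) (divides (m * a) (solve (m ∷ a ∷ b ∷ c ∷ d ∷ []))))
  where
  p≥1 : 1 ≤ p
  p≥1 = >-nonZero⁻¹ p {{prime⇒nonZero p-prime}}
  x≥1 : 1 ≤ a * b * d * p
  x≥1 = *-mono-≤ (*-mono-≤ (*-mono-≤ a≥1 b≥1) d≥1) p≥1
  y≥1 : 1 ≤ a * c * d
  y≥1 = *-mono-≤ (*-mono-≤ a≥1 c≥1) d≥1
  z≥1 : 1 ≤ b * c * d
  z≥1 = *-mono-≤ (*-mono-≤ b≥1 c≥1) d≥1
  p∤ : ∀ k → k ∣ m * a * b * c * d → ¬ p ∣ k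
  p∤ k k∣ p∣k = parameters⇒∤c m p a b c d 4≤m a≥1 b≥1 c≥1 d≥1 eq
    (∣m+n∣m⇒∣n (subst (p ∣_) eq (∣-trans p∣k k∣)) (m∣m*n (a + b)))
  solution : m * (a * b * d * p) * (a * c * d) * (b * c * d) ≡
    p * (a * c * d * (b * c * d) + a * b * d * p * (b * c * d) + a * b * d * p * (a * c * d))
  solution = begin
    m * (a * b * d * p) * (a * c * d) * (b * c * d) ≡⟨ solve (m ∷ p ∷ a ∷ b ∷ c ∷ d ∷ []) ⟩
    m * a * b * c * d * (p * a * b * c * d * d)     ≡⟨ cong (_* (p * a * b * c * d * d)) eq ⟩
    (p * (a + b) + c) * (p * a * b * c * d * d)     ≡⟨ solve (p ∷ a ∷ b ∷ c ∷ d ∷ []) ⟩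
    p * (a * c * d * (b * c * d) + a * b * d * p * (b * c * d) + a * b * d * p * (a * c * d)) ∎
    where open ≡-Reasoning

corollary2p2 : (m p : ℕ) → 4 ≤ m → Prime p →
    (∃[ x ] ∃[ y ] ∃[ z ] IsTypeI m p x y z) ⇔
    (∃[ a ] ∃[ d ] ∃[ f ] ((1 ≤ a) × (1 ≤ d) × (1 ≤ f) ×
      (f ∣ m * a * a * d + 1) × (m * a * d ∣ p + f)))
corollary2p2 m p 4≤m p-prime = mk⇔
  (λ (_ , _ , _ , typeI) →
    let a , b , c , d , a≥1 , c≥1 , d≥1 , p⊥c , eq = typeI⇒parameters m p typeI
        f , f≥1 , f∣ , mad∣ = parameters⇒divisibility m p a b c d c≥1 p⊥c eq
    in a , d , f , a≥1 , d≥1 , f≥1 , f∣ , mad∣)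
  (λ (a , d , f , a≥1 , d≥1 , f≥1 , f∣ , mad∣) →
    let b , c , b≥1 , c≥1 , eq = divisibility⇒parameters m p a d f f≥1 f∣ mad∣
    in a * b * d * p , a * c * d , b * c * d ,
       parameters⇒typeI m p a b c d p-prime 4≤m a≥1 b≥1 c≥1 d≥1 eq)
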